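{- Let $f\in\mathbb{Z}[x_1,\dots,x_d]$ and let $\mathbf{p}\in\operatorname{frame}(f)$. The following are equivalent: (i) $\mathbf{p}$ is a vertex of the Newton polytope $\operatorname{newton}(f)$; (ii) there exists a monotonic total preorder $\preceq$ on $\mathbb{Z}^d$ such that $\mathbf{p}=\max_\prec(\operatorname{frame}(f))$, i.e., $\mathbf{q}\prec\mathbf{p}$ for all $\mathbf{q}\in\operatorname{frame}(f)\setminus\{\mathbf{p}\}$.
   Context: Write $f=\sum_{\mathbf{p}\in F}f_\mathbf{p}\mathbf{x}^\mathbf{p}$ with $f_\mathbf{p}\neq 0$ and $F\subset\mathbb{N}^d$ finite, where $\mathbf{x}^\mathbf{p}=x_1^{p_1}\cdots x_d^{p_d}$; then $\operatorname{frame}(f)=F$. The Newton polytope is $\operatorname{newton}(f)=\operatorname{conv}(\operatorname{frame}(f))$. A point $\mathbf{p}$ is a vertex of a polytope $P\subseteq\mathbb{R}^d$ if there exists $\mathbf{n}\in\mathbb{R}^d$ with $\mathbf{n}^T\mathbf{p}>\mathbf{n}^T\mathbf{q}$ for all $\mathbf{q}\in P\setminus\{\mathbf{p}\}$. A monotonic total preorder on $\mathbb{Z}^d$ is a relation $\preceq$ on $\mathbb{Z}^d$ that is reflexive, transitive, monotonic ($\mathbf{x}\preceq\mathbf{y}$ implies $\mathbf{x}+\mathbf{z}\preceq\mathbf{y}+\mathbf{z}$ for all $\mathbf{z}\in\mathbb{Z}^d$) and total ($\mathbf{x}\preceq\mathbf{y}$ or $\mathbf{y}\preceq\mathbf{x}$).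 We write $\mathbf{x}\prec\mathbf{y}$ if $\mathbf{x}\preceq\mathbf{y}$ and not $\mathbf{y}\preceq\mathbf{x}$.
   Formalization: The Newton polytope is taken in ℚ^d rather than ℝ^d, with rational convex weights, and the vector n in the definition of a vertex has rational entries. -}

module Defs where

open import Data.Nat using (ℕ)
open import Data.Integer as ℤ using (ℤ; +_)
open import Data.Rational as ℚ using (ℚ; 0ℚ; 1ℚ)
open import Data.Vec as Vec using (Vec; map; zipWith; replicate; toList)
open import Data.List as List using (List)
open import Data.List.Membership.Propositional using (_∈_)
open import Data.List.Relation.Unary.All using (All)
open import Data.Product using (Σ; ∃; _×_; _,_; proj₁; proj₂)
open import Relation.Nullary using (¬_)
open import Relation.Binary.PropositionalEquality using (_≡_; _≢_)
open import Function.Bundles using (_⇔_)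
open import Data.Sum using (_⊎_)

-- A polynomial f ∈ ℤ[x₁,…,x_d]: a coefficient function on exponent vectors
-- together with a finite list enumerating exactly its support.
record Poly (d : ℕ) : Set where
  field
    coeff      : Vec ℕ d → ℤ
    frame      : List (Vec ℕ d)
    frame-spec : ∀ p → (p ∈ frame) ⇔ (coeff p ≢ ℤ.0ℤ)

open Poly public

toℤᵛ : ∀ {d} → Vec ℕ d → Vec ℤ d
toℤᵛ = map +_

toℚᵛ : ∀ {d} → Vec ℕ d → Vec ℚ d
toℚᵛ = map (λ n → ℚ._/_ (+ n) 1)

_+ᵛ_ : ∀ {d} → Vec ℚ d → Vec ℚ d → Vec ℚ d
_+ᵛ_ = zipWith ℚ._+_

_·ᵛ_ : ∀ {d} → ℚ → Vec ℚ d → Vec ℚ d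
w ·ᵛ x = map (ℚ._*_ w) x

dot : ∀ {d} → Vec ℚ d → Vec ℚ d → ℚ
dot n x = List.foldr ℚ._+_ 0ℚ (toList (zipWith ℚ._*_ n x))

combo : ∀ {d} → List (ℚ × Vec ℚ d) → Vec ℚ d
combo {d} = List.foldr (λ wx acc → (proj₁ wx ·ᵛ proj₂ wx) +ᵛ acc) (replicate d 0ℚ)

weightSum : ∀ {d} → List (ℚ × Vec ℚ d) → ℚ
weightSum ws = List.foldr ℚ._+_ 0ℚ (List.map proj₁ ws)

InConv : ∀ {d} → List (Vec ℚ d) → Vec ℚ d → Set
InConv {d} L x =
  Σ (List (ℚ × Vec ℚ d)) λ ws →
    All (λ wx → (0ℚ ℚ.≤ proj₁ wx) × (proj₂ wx ∈ L)) ws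
    × weightSum ws ≡ 1ℚ
    × combo ws ≡ x

-- Newton polytope, represented by its generating point list (as ℚ-vectors)
newton : ∀ {d} → Poly d → List (Vec ℚ d)
newton f = List.map toℚᵛ (frame f)

IsVertex : ∀ {d} → List (Vec ℚ d) → Vec ℚ d → Set
IsVertex {d} L p =
  ∃ λ (n : Vec ℚ d) → ∀ q → InConv L q → q ≢ p → dot n q ℚ.< dot n p

record MonotonicTotalPreorder (d : ℕ) : Set₁ where
  field
    _≼_   : Vec ℤ d → Vec ℤ d → Set
    refl  : ∀ x → x ≼ x
    trans : ∀ {x y z} → x ≼ y → y ≼ z → x ≼ z
    mono  : ∀ {x y} → x ≼ y → ∀ z → zipWith ℤ._+_ x z ≼ zipWith ℤ._+_ y z
    total : ∀ x y → (x ≼ y) ⊎ (y ≼ x)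

  _≺_ : Vec ℤ d → Vec ℤ d → Set
  x ≺ y = (x ≼ y) × ¬ (y ≼ x)

{-# OPTIONS --safe #-}
-- (i) ⇒ (ii): a normal n of the vertex orders ℤ^d by x ↦ n·x.
-- (ii) ⇒ (i): the elements v ≺ 0 of a monotonic preorder form a subsemigroup of ℤ^d that avoids 0
-- and contains q − p for every other point q of the frame. A finite subset of such a subsemigroup
-- lies in an open half-space {v | n·v < 0}, a form of Gordan's alternative, proved by
-- Fourier–Motzkin elimination: positive integer combinations of two vectors whose first coordinates
-- have opposite signs stay in the subsemigroup and kill that coordinate, induction on d gives the
-- remaining coordinates of n, and its first coordinate is chosen between the resulting bounds.
-- This n makes p the unique maximiser of x ↦ n·x on the frame, hence on its convex hull.

module Submission where

open import Defs
open import Data.Nat using (ℕ)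
open import Data.Vec using (Vec)
open import Data.Product using (∃)
open import Data.List.Membership.Propositional using (_∈_)
open import Relation.Binary.PropositionalEquality using (_≢_)
open import Function.Bundles using (_⇔_)

open import Data.Nat as ℕ using (zero; suc)
open import Data.Integer as ℤ using (ℤ; +_; +0; +[1+_]; -[1+_]; 0ℤ)
import Data.Integer.Properties as ℤP
open import Data.Integer.Tactic.RingSolver using (solve-∀)
open import Data.Rational as ℚ using (ℚ; 0ℚ; 1ℚ; _<_; _≤_; _÷_; Positive)
import Data.Rational.Properties as ℚP
open import Data.Rational.Literals using (fromℤ)
open import Data.Rational.Solver using (module +-*-Solver)
import Data.Rational.Unnormalised as ℚᵘ
import Data.Rational.Unnormalised.Properties as ℚᵘP
open import Data.Vec using ([]; _∷_; map; zipWith; replicate)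
import Data.Vec.Properties as VecP
open import Data.List as List using (List; []; _∷_; _++_; mapMaybe; filter; cartesianProductWith)
open import Data.List.Membership.Propositional.Properties
open import Data.List.Relation.Unary.Any using (here; there)
open import Data.List.Relation.Unary.All as All using (All; []; _∷_)
open import Relation.Binary.Bundles using (DecTotalOrder)
open import Data.List.Extrema (DecTotalOrder.totalOrder ℚP.≤-decTotalOrder)
  using (max; min; ⊥≤max; xs≤max; min≤⊤; min≤xs; argmax-all; argmin-all)
open import Data.Maybe using (Maybe; just; nothing)
open import Data.Product using (_×_; _,_; proj₁; proj₂)
open import Data.Sum using (_⊎_; inj₁; inj₂)
open import Data.Empty using (⊥-elim)
open import Function using (_∘_; id)
open import Relation.Nullary using (¬_; Dec; yes; no; ¬?)
open import Relation.Binary.PropositionalEquality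
open import Function.Bundles using (mk⇔)

private
  variable
    d : ℕ

∈-mapMaybe⁺ : ∀ {A B : Set} (f : A → Maybe B) {xs x y} →
              x ∈ xs → f x ≡ just y → y ∈ mapMaybe f xs
∈-mapMaybe⁺ f {x ∷ xs} (here refl) fx≡y rewrite fx≡y = here refl
∈-mapMaybe⁺ f {x ∷ xs} (there x∈) fx≡y with f x
... | just _  = there (∈-mapMaybe⁺ f x∈ fx≡y)
... | nothing = ∈-mapMaybe⁺ f x∈ fx≡y

∈-mapMaybe⁻ : ∀ {A B : Set} (f : A → Maybe B) {xs y} →
              y ∈ mapMaybe f xs → ∃ λ x → x ∈ xs × f x ≡ just y
∈-mapMaybe⁻ f {x ∷ xs} y∈ with f x in fx≡
... | nothing = let (x′ , x′∈ , eq) = ∈-mapMaybe⁻ f y∈ in x′ , there x′∈ , eq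
... | just _ with y∈
...   | here refl = x , here refl , fx≡
...   | there y∈′ = let (x′ , x′∈ , eq) = ∈-mapMaybe⁻ f y∈′ in x′ , there x′∈ , eq

fromℤ-+ : ∀ a b → fromℤ (a ℤ.+ b) ≡ fromℤ a ℚ.+ fromℤ b
fromℤ-+ a b = ℚP.toℚᵘ-injective (ℚᵘP.≃-trans
  (ℚᵘ.*≡* (cross-multiplied a b)) (ℚᵘP.≃-sym (ℚP.toℚᵘ-homo-+ (fromℤ a) (fromℤ b))))
  where
  cross-multiplied : ∀ a b → (a ℤ.+ b) ℤ.* + 1 ≡ (a ℤ.* + 1 ℤ.+ b ℤ.* + 1) ℤ.* + 1
  cross-multiplied = solve-∀

fromℤ-* : ∀ a b → fromℤ (a ℤ.* b) ≡ fromℤ a ℚ.* fromℤ b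
fromℤ-* a b = ℚP.toℚᵘ-injective (ℚᵘP.≃-sym (ℚP.toℚᵘ-homo-* (fromℤ a) (fromℤ b)))

fromℤ-+-/1 : ∀ n → fromℤ (+ n) ≡ + n ℚ./ 1
fromℤ-+-/1 n = sym (ℚP.normalize-coprime _)

fromℤᵛ : Vec ℤ d → Vec ℚ d
fromℤᵛ = map fromℤ

fromℤᵛ∘toℤᵛ : (q : Vec ℕ d) → fromℤᵛ (toℤᵛ q) ≡ toℚᵛ q
fromℤᵛ∘toℤᵛ q = trans (sym (VecP.map-∘ fromℤ +_ q)) (VecP.map-cong fromℤ-+-/1 q)

toℚᵛ-injective : {q p : Vec ℕ d} → toℚᵛ q ≡ toℚᵛ p → q ≡ p
toℚᵛ-injective {q = []} {[]} _ = refl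
toℚᵛ-injective {q = a ∷ q} {b ∷ p} eq with VecP.∷-injective eq
... | a≡b , q≡p = cong₂ _∷_ (ℤP.+-injective (cong ℚ.↥_ a/1≡b/1)) (toℚᵛ-injective q≡p)
  where
  a/1≡b/1 : fromℤ (+ a) ≡ fromℤ (+ b)
  a/1≡b/1 = trans (fromℤ-+-/1 a) (trans a≡b (sym (fromℤ-+-/1 b)))

0ᶻ : Vec ℤ d
0ᶻ = replicate _ 0ℤ

infixl 6 _+ᶻ_ _-ᶻ_
infixr 7 _·ᶻ_

_+ᶻ_ : Vec ℤ d → Vec ℤ d → Vec ℤ d
_+ᶻ_ = zipWith ℤ._+_

_-ᶻ_ : Vec ℤ d → Vec ℤ d → Vec ℤ d
x -ᶻ y = x +ᶻ map ℤ.-_ y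

_·ᶻ_ : ℤ → Vec ℤ d → Vec ℤ d
c ·ᶻ x = map (c ℤ.*_) x

+ᶻ-identityˡ : (x : Vec ℤ d) → 0ᶻ +ᶻ x ≡ x
+ᶻ-identityˡ = VecP.zipWith-identityˡ ℤP.+-identityˡ

-ᶻ-self : (x : Vec ℤ d) → x -ᶻ x ≡ 0ᶻ
-ᶻ-self = VecP.zipWith-inverseʳ ℤP.+-inverseʳ

-ᶻ-+ᶻ-cancel : (x y : Vec ℤ d) → (x -ᶻ y) +ᶻ y ≡ x
-ᶻ-+ᶻ-cancel x y = begin
  (x -ᶻ y) +ᶻ y            ≡⟨ VecP.zipWith-assoc ℤP.+-assoc x (map ℤ.-_ y) y ⟩
  x +ᶻ (map ℤ.-_ y +ᶻ y)   ≡⟨ cong (x +ᶻ_) (VecP.zipWith-inverseˡ ℤP.+-inverseˡ y) ⟩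
  x +ᶻ 0ᶻ                  ≡⟨ VecP.zipWith-identityʳ ℤP.+-identityʳ x ⟩
  x                        ∎
  where open ≡-Reasoning

·ᶻ-identityˡ : (x : Vec ℤ d) → + 1 ·ᶻ x ≡ x
·ᶻ-identityˡ x = trans (VecP.map-cong ℤP.*-identityˡ x) (VecP.map-id x)

·ᶻ-suc : ∀ m (x : Vec ℤ d) → +[1+ suc m ] ·ᶻ x ≡ x +ᶻ +[1+ m ] ·ᶻ x
·ᶻ-suc m []      = refl
·ᶻ-suc m (h ∷ x) = cong₂ _∷_ (ℤP.suc-* +[1+ m ] h) (·ᶻ-suc m x)

+ᵛ-identityˡ : (x : Vec ℚ d) → replicate d 0ℚ +ᵛ x ≡ x
+ᵛ-identityˡ = VecP.zipWith-identityˡ ℚP.+-identityˡ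

+ᵛ-identityʳ : (x : Vec ℚ d) → x +ᵛ replicate d 0ℚ ≡ x
+ᵛ-identityʳ = VecP.zipWith-identityʳ ℚP.+-identityʳ

·ᵛ-identityˡ : (x : Vec ℚ d) → 1ℚ ·ᵛ x ≡ x
·ᵛ-identityˡ x = trans (VecP.map-cong ℚP.*-identityˡ x) (VecP.map-id x)

·ᵛ-zeroˡ : (x : Vec ℚ d) → 0ℚ ·ᵛ x ≡ replicate d 0ℚ
·ᵛ-zeroˡ x = trans (VecP.map-cong ℚP.*-zeroˡ x) (VecP.map-const x 0ℚ)

·ᵛ-distribʳ : ∀ w v (x : Vec ℚ d) → (w ·ᵛ x) +ᵛ (v ·ᵛ x) ≡ (w ℚ.+ v) ·ᵛ x
·ᵛ-distribʳ w v []      = refl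
·ᵛ-distribʳ w v (a ∷ x) = cong₂ _∷_ (sym (ℚP.*-distribʳ-+ a w v)) (·ᵛ-distribʳ w v x)

dotℤ : Vec ℚ d → Vec ℤ d → ℚ
dotℤ n x = dot n (fromℤᵛ x)

dot-+ᵛ : (n x y : Vec ℚ d) → dot n (x +ᵛ y) ≡ dot n x ℚ.+ dot n y
dot-+ᵛ []      []      []      = refl
dot-+ᵛ (a ∷ n) (b ∷ x) (c ∷ y) rewrite dot-+ᵛ n x y =
  solve 5 (λ a b c u v → a :* (b :+ c) :+ (u :+ v) := (a :* b :+ u) :+ (a :* c :+ v))
    refl a b c (dot n x) (dot n y)
  where open +-*-Solver

dot-·ᵛ : (n : Vec ℚ d) (w : ℚ) (x : Vec ℚ d) → dot n (w ·ᵛ x) ≡ w ℚ.* dot n x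
dot-·ᵛ []      w []      = sym (ℚP.*-zeroʳ w)
dot-·ᵛ (a ∷ n) w (b ∷ x) rewrite dot-·ᵛ n w x =
  solve 4 (λ a w b u → a :* (w :* b) :+ w :* u := w :* (a :* b :+ u)) refl a w b (dot n x)
  where open +-*-Solver

fromℤᵛ-+ᶻ : (x y : Vec ℤ d) → fromℤᵛ (x +ᶻ y) ≡ fromℤᵛ x +ᵛ fromℤᵛ y
fromℤᵛ-+ᶻ []      []      = refl
fromℤᵛ-+ᶻ (a ∷ x) (b ∷ y) = cong₂ _∷_ (fromℤ-+ a b) (fromℤᵛ-+ᶻ x y)

fromℤᵛ-·ᶻ : ∀ c (x : Vec ℤ d) → fromℤᵛ (c ·ᶻ x) ≡ fromℤ c ·ᵛ fromℤᵛ x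
fromℤᵛ-·ᶻ c x = begin
  map fromℤ (map (c ℤ.*_) x)        ≡⟨ VecP.map-∘ fromℤ (c ℤ.*_) x ⟨
  map (fromℤ ∘ (c ℤ.*_)) x          ≡⟨ VecP.map-cong (fromℤ-* c) x ⟩
  map ((fromℤ c ℚ.*_) ∘ fromℤ) x    ≡⟨ VecP.map-∘ (fromℤ c ℚ.*_) fromℤ x ⟩
  map (fromℤ c ℚ.*_) (map fromℤ x)  ∎
  where open ≡-Reasoning

dotℤ-+ᶻ : (n : Vec ℚ d) (x y : Vec ℤ d) → dotℤ n (x +ᶻ y) ≡ dotℤ n x ℚ.+ dotℤ n y
dotℤ-+ᶻ n x y = trans (cong (dot n) (fromℤᵛ-+ᶻ x y)) (dot-+ᵛ n (fromℤᵛ x) (fromℤᵛ y))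

dotℤ-·ᶻ : (n : Vec ℚ d) (c : ℤ) (x : Vec ℤ d) → dotℤ n (c ·ᶻ x) ≡ fromℤ c ℚ.* dotℤ n x
dotℤ-·ᶻ n c x = trans (cong (dot n) (fromℤᵛ-·ᶻ c x)) (dot-·ᵛ n (fromℤ c) (fromℤᵛ x))

dotℤ-toℤᵛ : (n : Vec ℚ d) (q : Vec ℕ d) → dotℤ n (toℤᵛ q) ≡ dot n (toℚᵛ q)
dotℤ-toℤᵛ n q = cong (dot n) (fromℤᵛ∘toℤᵛ q)

record IsZeroFreeSubsemigroup (S : Vec ℤ d → Set) : Set where
  field
    +ᶻ-closed : ∀ {x y} → S x → S y → S (x +ᶻ y)
    0ᶻ∉ : ¬ S 0ᶻ

  ·ᶻ-closed : ∀ m {x} → S x → S (+[1+ m ] ·ᶻ x)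
  ·ᶻ-closed zero    {x} x∈S = subst S (sym (·ᶻ-identityˡ x)) x∈S
  ·ᶻ-closed (suc m) {x} x∈S = subst S (sym (·ᶻ-suc m x)) (+ᶻ-closed x∈S (·ᶻ-closed m x∈S))

open IsZeroFreeSubsemigroup

restrictToHyperplane : {S : Vec ℤ (suc d) → Set} →
  IsZeroFreeSubsemigroup S → IsZeroFreeSubsemigroup (λ t → S (0ℤ ∷ t))
restrictToHyperplane isS = record { +ᶻ-closed = +ᶻ-closed isS ; 0ᶻ∉ = 0ᶻ∉ isS }

module _ (R : MonotonicTotalPreorder d) where
  open MonotonicTotalPreorder R using (_≼_; _≺_; mono) renaming (trans to ≼-trans)

  negativeCone : IsZeroFreeSubsemigroup (_≺ 0ᶻ)
  negativeCone = record { +ᶻ-closed = closed ; 0ᶻ∉ = λ (0≼0 , 0⋠0) → 0⋠0 0≼0 }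
    where
    closed : ∀ {x y} → x ≺ 0ᶻ → y ≺ 0ᶻ → (x +ᶻ y) ≺ 0ᶻ
    closed {x} {y} (x≼0 , 0⋠x) (y≼0 , 0⋠y) =
      ≼-trans x+y≼y y≼0 , λ 0≼x+y → 0⋠y (≼-trans 0≼x+y x+y≼y)
      where
      x+y≼y : (x +ᶻ y) ≼ y
      x+y≼y = subst ((x +ᶻ y) ≼_) (+ᶻ-identityˡ y) (mono x≼0 y)

  ≺⇒-ᶻ≺0 : ∀ {x y} → x ≺ y → (x -ᶻ y) ≺ 0ᶻ
  ≺⇒-ᶻ≺0 {x} {y} (x≼y , y⋠x) =
    subst ((x -ᶻ y) ≼_) (-ᶻ-self y) (mono x≼y (map ℤ.-_ y)) ,
    λ 0≼x-y → y⋠x (subst₂ _≼_ (+ᶻ-identityˡ y) (-ᶻ-+ᶻ-cancel x y) (mono 0≼x-y y))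

x-1<x : ∀ x → x ℚ.- 1ℚ < x
x-1<x x = subst (x ℚ.- 1ℚ <_) (ℚP.+-identityʳ x) (ℚP.+-monoʳ-< x (ℚP.negative⁻¹ (ℚ.- 1ℚ)))

x<x+1 : ∀ x → x < x ℚ.+ 1ℚ
x<x+1 x = subst (_< x ℚ.+ 1ℚ) (ℚP.+-identityʳ x) (ℚP.+-monoʳ-< x (ℚP.positive⁻¹ 1ℚ))

max<min : ∀ l ls u us → All (λ l′ → All (l′ <_) (u ∷ us)) (l ∷ ls) → max l ls < min u us
max<min l ls u us (l<u∷us ∷ ls<u∷us) = argmax-all id (below-min l<u∷us) (All.map below-min ls<u∷us)
  where
  below-min : ∀ {l′} → All (l′ <_) (u ∷ us) → l′ < min u us
  below-min (l′<u ∷ l′<us) = argmin-all id l′<u l′<us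

between : (Ls Us : List ℚ) → All (λ l → All (l <_) Us) Ls →
          ∃ λ x → All (_< x) Ls × All (x <_) Us
between []       []       _ = 0ℚ , [] , []
between []       (u ∷ us) _ =
  min u us ℚ.- 1ℚ , [] , All.map (ℚP.<-≤-trans (x-1<x _)) (min≤⊤ u us ∷ min≤xs u us)
between (l ∷ ls) []       _ =
  max l ls ℚ.+ 1ℚ , All.map (λ l≤M → ℚP.≤-<-trans l≤M (x<x+1 _)) (⊥≤max l ls ∷ xs≤max l ls)
                  , []
between (l ∷ ls) (u ∷ us) Ls<Us with ℚP.<-dense (max<min l ls u us Ls<Us)
... | x , M<x , x<m = x , All.map (λ l≤M → ℚP.≤-<-trans l≤M M<x) (⊥≤max l ls ∷ xs≤max l ls)
                        , All.map (ℚP.<-≤-trans x<m) (min≤⊤ u us ∷ min≤xs u us)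

<⇒-<0 : ∀ {a b} → a < b → a ℚ.- b < 0ℚ
<⇒-<0 {a} {b} a<b = subst (a ℚ.- b <_) (ℚP.+-inverseʳ b) (ℚP.+-monoˡ-< (ℚ.- b) a<b)

-<0⇒< : ∀ {a b} → a ℚ.- b < 0ℚ → a < b
-<0⇒< {a} {b} a-b<0 = subst₂ _<_ (a-b+b≡a a b) (ℚP.+-identityˡ b) (ℚP.+-monoˡ-< b a-b<0)
  where
  open +-*-Solver
  a-b+b≡a : ∀ a b → a ℚ.- b ℚ.+ b ≡ a
  a-b+b≡a = solve 2 (λ a b → a :- b :+ b := a) refl

module _ (c : ℚ) .{{c>0 : Positive c}} where
  private instance
    c≢0 : ℚ.NonZero c
    c≢0 = ℚP.pos⇒nonZero c

  open +-*-Solver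

  ÷-*-cancel : ∀ y → (y ÷ c) ℚ.* c ≡ y
  ÷-*-cancel y = begin
    (y ℚ.* ℚ.1/ c) ℚ.* c  ≡⟨ ℚP.*-assoc y (ℚ.1/ c) c ⟩
    y ℚ.* (ℚ.1/ c ℚ.* c)  ≡⟨ cong (y ℚ.*_) (ℚP.*-inverseˡ c) ⟩
    y ℚ.* 1ℚ              ≡⟨ ℚP.*-identityʳ y ⟩
    y                     ∎
    where open ≡-Reasoning

  <-neg÷⇒*+<0 : ∀ {x α} → x < ℚ.- α ÷ c → x ℚ.* c ℚ.+ α < 0ℚ
  <-neg÷⇒*+<0 {x} {α} x<-α/c = subst (_< 0ℚ) (rearrange x c α) (<⇒-<0 xc<-α)
    where
    xc<-α : x ℚ.* c < ℚ.- α
    xc<-α = subst (x ℚ.* c <_) (÷-*-cancel (ℚ.- α)) (ℚP.*-monoˡ-<-pos c x<-α/c)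
    rearrange : ∀ x c α → x ℚ.* c ℚ.- ℚ.- α ≡ x ℚ.* c ℚ.+ α
    rearrange = solve 3 (λ x c α → x :* c :- (:- α) := x :* c :+ α) refl

  ÷<⇒*neg+<0 : ∀ {x β} → β ÷ c < x → x ℚ.* ℚ.- c ℚ.+ β < 0ℚ
  ÷<⇒*neg+<0 {x} {β} β/c<x = subst (_< 0ℚ) (rearrange x c β) (<⇒-<0 β<xc)
    where
    β<xc : β < x ℚ.* c
    β<xc = subst (_< x ℚ.* c) (÷-*-cancel β) (ℚP.*-monoˡ-<-pos c β/c<x)
    rearrange : ∀ x c β → β ℚ.- x ℚ.* c ≡ x ℚ.* ℚ.- c ℚ.+ β
    rearrange = solve 3 (λ x c β → β :- x :* c := x :* (:- c) :+ β) refl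

module _ (cₖ cₘ : ℚ) .{{cₖ>0 : Positive cₖ}} .{{cₘ>0 : Positive cₘ}} where
  private instance
    cₖ≢0 : ℚ.NonZero cₖ
    cₖ≢0 = ℚP.pos⇒nonZero cₖ
    cₘ≢0 : ℚ.NonZero cₘ
    cₘ≢0 = ℚP.pos⇒nonZero cₘ
    cₘcₖ≥0 : ℚ.NonNegative (cₘ ℚ.* cₖ)
    cₘcₖ≥0 = ℚP.pos⇒nonNeg (cₘ ℚ.* cₖ) {{ℚP.pos*pos⇒pos cₘ cₖ}}

  ÷<-neg÷ : ∀ {α β} → cₘ ℚ.* α ℚ.+ cₖ ℚ.* β < 0ℚ → β ÷ cₘ < ℚ.- α ÷ cₖ
  ÷<-neg÷ {α} {β} elim<0 = ℚP.*-cancelʳ-<-nonNeg (cₘ ℚ.* cₖ) (begin-strict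
    (β ÷ cₘ) ℚ.* (cₘ ℚ.* cₖ)       ≡⟨ reassoc (β ÷ cₘ) cₘ cₖ ⟩
    (β ÷ cₘ) ℚ.* cₘ ℚ.* cₖ         ≡⟨ cong (ℚ._* cₖ) (÷-*-cancel cₘ β) ⟩
    β ℚ.* cₖ                        <⟨ -<0⇒< (subst (_< 0ℚ) (rearrange α β cₖ cₘ) elim<0) ⟩
    ℚ.- α ℚ.* cₘ                    ≡⟨ cong (ℚ._* cₘ) (÷-*-cancel cₖ (ℚ.- α)) ⟨
    (ℚ.- α ÷ cₖ) ℚ.* cₖ ℚ.* cₘ     ≡⟨ reassoc′ (ℚ.- α ÷ cₖ) cₖ cₘ ⟩
    (ℚ.- α ÷ cₖ) ℚ.* (cₘ ℚ.* cₖ)   ∎)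
    where
    open ℚP.≤-Reasoning
    open +-*-Solver
    reassoc : ∀ x a b → x ℚ.* (a ℚ.* b) ≡ x ℚ.* a ℚ.* b
    reassoc = solve 3 (λ x a b → x :* (a :* b) := x :* a :* b) refl
    reassoc′ : ∀ x a b → x ℚ.* a ℚ.* b ≡ x ℚ.* (b ℚ.* a)
    reassoc′ = solve 3 (λ x a b → x :* a :* b := x :* (b :* a)) refl
    rearrange : ∀ α β cₖ cₘ → cₘ ℚ.* α ℚ.+ cₖ ℚ.* β ≡ β ℚ.* cₖ ℚ.- ℚ.- α ℚ.* cₘ
    rearrange = solve 4 (λ α β cₖ cₘ → cₘ :* α :+ cₖ :* β := β :* cₖ :- (:- α) :* cₘ) refl

InOpenHalfspace : List (Vec ℤ d) → Set
InOpenHalfspace vs = ∃ λ n → ∀ {v} → v ∈ vs → dotℤ n v < 0ℚ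

headZero : Vec ℤ (suc d) → Maybe (Vec ℤ d)
headZero (+0 ∷ t) = just t
headZero _        = nothing

headPos : Vec ℤ (suc d) → Maybe (ℕ × Vec ℤ d)
headPos (+[1+ k ] ∷ t) = just (k , t)
headPos _              = nothing

headNeg : Vec ℤ (suc d) → Maybe (ℕ × Vec ℤ d)
headNeg (-[1+ m ] ∷ t) = just (m , t)
headNeg _              = nothing

headZero-just : ∀ {v : Vec ℤ (suc d)} {t} → headZero v ≡ just t → v ≡ +0 ∷ t
headZero-just {v = +0       ∷ _} refl = refl
headZero-just {v = +[1+ _ ] ∷ _} ()
headZero-just {v = -[1+ _ ] ∷ _} ()

headPos-just : ∀ {v : Vec ℤ (suc d)} {k t} → headPos v ≡ just (k , t) → v ≡ +[1+ k ] ∷ t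
headPos-just {v = +[1+ _ ] ∷ _} refl = refl
headPos-just {v = +0       ∷ _} ()
headPos-just {v = -[1+ _ ] ∷ _} ()

headNeg-just : ∀ {v : Vec ℤ (suc d)} {m t} → headNeg v ≡ just (m , t) → v ≡ -[1+ m ] ∷ t
headNeg-just {v = -[1+ _ ] ∷ _} refl = refl
headNeg-just {v = +0       ∷ _} ()
headNeg-just {v = +[1+ _ ] ∷ _} ()

module FourierMotzkin {S : Vec ℤ (suc d) → Set} (isS : IsZeroFreeSubsemigroup S)
  (vs : List (Vec ℤ (suc d))) (vs⊆S : ∀ {v} → v ∈ vs → S v) where

  zeros : List (Vec ℤ d)
  zeros = mapMaybe headZero vs

  positives negatives : List (ℕ × Vec ℤ d)
  positives = mapMaybe headPos vs
  negatives = mapMaybe headNeg vs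

  eliminate : ℕ × Vec ℤ d → ℕ × Vec ℤ d → Vec ℤ d
  eliminate (k , a) (m , b) = +[1+ m ] ·ᶻ a +ᶻ +[1+ k ] ·ᶻ b

  reduced : List (Vec ℤ d)
  reduced = zeros ++ cartesianProductWith eliminate positives negatives

  eliminate∈S : ∀ {k a m b} → S (+[1+ k ] ∷ a) → S (-[1+ m ] ∷ b) →
                S (0ℤ ∷ eliminate (k , a) (m , b))
  eliminate∈S {k} {a} {m} {b} ka∈S mb∈S =
    subst (λ h → S (h ∷ eliminate (k , a) (m , b))) (cross-cancel +[1+ m ] +[1+ k ])
      (+ᶻ-closed isS (·ᶻ-closed isS m ka∈S) (·ᶻ-closed isS k mb∈S))
    where
    cross-cancel : ∀ a b → a ℤ.* b ℤ.+ b ℤ.* ℤ.- a ≡ 0ℤ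
    cross-cancel = solve-∀

  reduced⊆S : ∀ {t} → t ∈ reduced → S (0ℤ ∷ t)
  reduced⊆S t∈ with ∈-++⁻ zeros t∈
  ... | inj₁ t∈zeros with ∈-mapMaybe⁻ headZero t∈zeros
  ...   | v , v∈ , eq = subst S (headZero-just eq) (vs⊆S v∈)
  reduced⊆S t∈ | inj₂ t∈elim with ∈-cartesianProductWith⁻ eliminate positives negatives t∈elim
  ...   | (k , a) , (m , b) , ka∈ , mb∈ , refl
    with ∈-mapMaybe⁻ headPos ka∈ | ∈-mapMaybe⁻ headNeg mb∈
  ...     | u , u∈ , u≡ | w , w∈ , w≡ =
    eliminate∈S (subst S (headPos-just u≡) (vs⊆S u∈)) (subst S (headNeg-just w≡) (vs⊆S w∈))

  module Lift (n : Vec ℚ d) (reduced<0 : ∀ {t} → t ∈ reduced → dotℤ n t < 0ℚ) where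

    -- For h ∷ t ∈ vs, x·h + n·t < 0 means x < upper (k , t) if h = 1 + k,
    -- and lower (m , t) < x if h = -(1 + m).
    upper lower : ℕ × Vec ℤ d → ℚ
    upper (k , a) = ℚ.- dotℤ n a ÷ fromℤ +[1+ k ]
    lower (m , b) = dotℤ n b ÷ fromℤ +[1+ m ]

    lower<upper : ∀ {l u} → l ∈ List.map lower negatives → u ∈ List.map upper positives → l < u
    lower<upper l∈ u∈ with ∈-map⁻ lower l∈ | ∈-map⁻ upper u∈
    ... | (m , b) , mb∈ , refl | (k , a) , ka∈ , refl =
      ÷<-neg÷ (fromℤ +[1+ k ]) (fromℤ +[1+ m ]) {dotℤ n a} {dotℤ n b}
        (subst (_< 0ℚ) dot-eliminate
          (reduced<0 (∈-++⁺ʳ zeros (∈-cartesianProductWith⁺ eliminate ka∈ mb∈))))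
      where
      dot-eliminate : dotℤ n (eliminate (k , a) (m , b)) ≡
                      fromℤ +[1+ m ] ℚ.* dotℤ n a ℚ.+ fromℤ +[1+ k ] ℚ.* dotℤ n b
      dot-eliminate = trans (dotℤ-+ᶻ n (+[1+ m ] ·ᶻ a) (+[1+ k ] ·ᶻ b))
                            (cong₂ ℚ._+_ (dotℤ-·ᶻ n +[1+ m ] a) (dotℤ-·ᶻ n +[1+ k ] b))

    separation : ∃ λ x → All (_< x) (List.map lower negatives) × All (x <_) (List.map upper positives)
    separation = between (List.map lower negatives) (List.map upper positives)
      (All.tabulate λ l∈ → All.tabulate λ u∈ → lower<upper l∈ u∈)

    x : ℚ
    x = proj₁ separation

    lifted<0 : ∀ {v} → v ∈ vs → dotℤ (x ∷ n) v < 0ℚ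
    lifted<0 {+0 ∷ t} v∈ =
      subst (_< 0ℚ) (sym x*0+t≡t) (reduced<0 (∈-++⁺ˡ (∈-mapMaybe⁺ headZero v∈ refl)))
      where
      x*0+t≡t : x ℚ.* 0ℚ ℚ.+ dotℤ n t ≡ dotℤ n t
      x*0+t≡t = trans (cong (ℚ._+ dotℤ n t) (ℚP.*-zeroʳ x)) (ℚP.+-identityˡ (dotℤ n t))
    lifted<0 {+[1+ k ] ∷ a} v∈ = <-neg÷⇒*+<0 (fromℤ +[1+ k ])
      (All.lookup (proj₂ (proj₂ separation)) (∈-map⁺ upper (∈-mapMaybe⁺ headPos v∈ refl)))
    lifted<0 { -[1+ m ] ∷ b} v∈ = ÷<⇒*neg+<0 (fromℤ +[1+ m ])
      (All.lookup (proj₁ (proj₂ separation)) (∈-map⁺ lower (∈-mapMaybe⁺ headNeg v∈ refl)))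

  lift : InOpenHalfspace reduced → InOpenHalfspace vs
  lift (n , reduced<0) = x ∷ n , lifted<0
    where open Lift n reduced<0

gordan : ∀ d {S : Vec ℤ d → Set} → IsZeroFreeSubsemigroup S →
         (vs : List (Vec ℤ d)) → (∀ {v} → v ∈ vs → S v) → InOpenHalfspace vs
gordan zero    isS vs vs⊆S = [] , λ { {[]} v∈ → ⊥-elim (0ᶻ∉ isS (vs⊆S v∈)) }
gordan (suc d) isS vs vs⊆S = lift (gordan d (restrictToHyperplane isS) reduced reduced⊆S)
  where open FourierMotzkin isS vs vs⊆S

preorderMax⇒linearMax : (R : MonotonicTotalPreorder d) (y : Vec ℤ d) (xs : List (Vec ℤ d)) →
  (∀ {x} → x ∈ xs → MonotonicTotalPreorder._≺_ R x y) →
  ∃ λ n → ∀ {x} → x ∈ xs → dotℤ n x < dotℤ n y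
preorderMax⇒linearMax {d} R y xs xs≺y with gordan d (negativeCone R) (List.map (_-ᶻ y) xs) differences≺0
  where
  differences≺0 : ∀ {v} → v ∈ List.map (_-ᶻ y) xs → MonotonicTotalPreorder._≺_ R v 0ᶻ
  differences≺0 v∈ with ∈-map⁻ (_-ᶻ y) v∈
  ... | x , x∈ , refl = ≺⇒-ᶻ≺0 R (xs≺y x∈)
... | n , differences<0 = n , λ x∈ → below-y (differences<0 (∈-map⁺ (_-ᶻ y) x∈))
  where
  below-y : ∀ {x} → dotℤ n (x -ᶻ y) < 0ℚ → dotℤ n x < dotℤ n y
  below-y {x} x-y<0 = begin-strict
    dotℤ n x                      ≡⟨ cong (dotℤ n) (-ᶻ-+ᶻ-cancel x y) ⟨
    dotℤ n ((x -ᶻ y) +ᶻ y)        ≡⟨ dotℤ-+ᶻ n (x -ᶻ y) y ⟩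
    dotℤ n (x -ᶻ y) ℚ.+ dotℤ n y  <⟨ ℚP.+-monoˡ-< (dotℤ n y) x-y<0 ⟩
    0ℚ ℚ.+ dotℤ n y               ≡⟨ ℚP.+-identityˡ (dotℤ n y) ⟩
    dotℤ n y                      ∎
    where open ℚP.≤-Reasoning

linearPreorder : Vec ℚ d → MonotonicTotalPreorder d
linearPreorder n = record
  { _≼_   = λ x y → dotℤ n x ≤ dotℤ n y
  ; refl  = λ _ → ℚP.≤-refl
  ; trans = ℚP.≤-trans
  ; mono  = λ {x} {y} x≤y z →
      subst₂ _≤_ (sym (dotℤ-+ᶻ n x z)) (sym (dotℤ-+ᶻ n y z)) (ℚP.+-monoˡ-≤ (dotℤ n z) x≤y)
  ; total = λ x y → ℚP.≤-total (dotℤ n x) (dotℤ n y)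
  }

linearPreorder-≺ : (n : Vec ℚ d) {x y : Vec ℤ d} →
                   dotℤ n x < dotℤ n y → MonotonicTotalPreorder._≺_ (linearPreorder n) x y
linearPreorder-≺ n x<y = ℚP.<⇒≤ x<y , λ y≤x → ℚP.<-irrefl refl (ℚP.<-≤-trans x<y y≤x)

StrictMaximiser : Vec ℚ d → List (Vec ℚ d) → Vec ℚ d → Set
StrictMaximiser n L p = ∀ {x} → x ∈ L → x ≢ p → dot n x < dot n p

∈⇒InConv : {L : List (Vec ℚ d)} {x : Vec ℚ d} → x ∈ L → InConv L x
∈⇒InConv {x = x} x∈ =
  ((1ℚ , x) ∷ []) , ((ℚP.nonNegative⁻¹ 1ℚ , x∈) ∷ []) , ℚP.+-identityʳ 1ℚ , 1·x+0≡x
  where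
  1·x+0≡x : (1ℚ ·ᵛ x) +ᵛ replicate _ 0ℚ ≡ x
  1·x+0≡x = trans (+ᵛ-identityʳ (1ℚ ·ᵛ x)) (·ᵛ-identityˡ x)

IsVertex⇒StrictMaximiser : {L : List (Vec ℚ d)} {p : Vec ℚ d} →
                           IsVertex L p → ∃ λ n → StrictMaximiser n L p
IsVertex⇒StrictMaximiser (n , vertex) = n , λ x∈ x≢p → vertex _ (∈⇒InConv x∈) x≢p

module _ (n : Vec ℚ d) {L : List (Vec ℚ d)} {p : Vec ℚ d} (p-max : StrictMaximiser n L p) where

  Weighted : ℚ × Vec ℚ d → Set
  Weighted (w , x) = 0ℚ ≤ w × x ∈ L

  maximiser-≤ : ∀ {x} → x ∈ L → dot n x ≤ dot n p
  maximiser-≤ {x} x∈ with VecP.≡-dec ℚP._≟_ x p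
  ... | yes refl = ℚP.≤-refl
  ... | no x≢p   = ℚP.<⇒≤ (p-max x∈ x≢p)

  combo-below-or-at : ∀ ws → All Weighted ws →
    dot n (combo ws) < weightSum ws ℚ.* dot n p ⊎ combo ws ≡ weightSum ws ·ᵛ p
  combo-below-or-at [] [] = inj₂ (sym (·ᵛ-zeroˡ p))
  combo-below-or-at ((w , x) ∷ ws) ((w≥0 , x∈) ∷ ws-ok) = step (combo-below-or-at ws ws-ok)
    where
    W : ℚ
    W = weightSum ws
    dot-combo : dot n (combo ((w , x) ∷ ws)) ≡ w ℚ.* dot n x ℚ.+ dot n (combo ws)
    dot-combo = trans (dot-+ᵛ n (w ·ᵛ x) (combo ws)) (cong (ℚ._+ dot n (combo ws)) (dot-·ᵛ n w x))
    below : w ℚ.* dot n x ℚ.+ dot n (combo ws) < w ℚ.* dot n p ℚ.+ W ℚ.* dot n p →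
            dot n (combo ((w , x) ∷ ws)) < (w ℚ.+ W) ℚ.* dot n p
    below = subst₂ _<_ (sym dot-combo) (sym (ℚP.*-distribʳ-+ (dot n p) w W))
    step : dot n (combo ws) < W ℚ.* dot n p ⊎ combo ws ≡ W ·ᵛ p →
           dot n (combo ((w , x) ∷ ws)) < (w ℚ.+ W) ℚ.* dot n p
             ⊎ combo ((w , x) ∷ ws) ≡ (w ℚ.+ W) ·ᵛ p
    step (inj₁ rest-below) = inj₁ (below
      (ℚP.+-mono-≤-< (ℚP.*-monoˡ-≤-nonNeg w {{ℚ.nonNegative w≥0}} (maximiser-≤ x∈)) rest-below))
    step (inj₂ rest-at) with VecP.≡-dec ℚP._≟_ x p | w ℚP.≟ 0ℚ
    ... | yes refl | _        = inj₂ (trans (cong ((w ·ᵛ p) +ᵛ_) rest-at) (·ᵛ-distribʳ w W p))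
    ... | no _     | yes refl = inj₂ (begin
      (0ℚ ·ᵛ x) +ᵛ combo ws           ≡⟨ cong₂ _+ᵛ_ (·ᵛ-zeroˡ x) rest-at ⟩
      replicate _ 0ℚ +ᵛ (W ·ᵛ p)      ≡⟨ +ᵛ-identityˡ (W ·ᵛ p) ⟩
      W ·ᵛ p                          ≡⟨ cong (_·ᵛ p) (ℚP.+-identityˡ W) ⟨
      (0ℚ ℚ.+ W) ·ᵛ p                 ∎)
      where open ≡-Reasoning
    ... | no x≢p   | no w≢0   = inj₁ (below (ℚP.+-mono-<-≤ (ℚP.*-monoʳ-<-pos w (p-max x∈ x≢p))
                                               (ℚP.≤-reflexive (trans (cong (dot n) rest-at) (dot-·ᵛ n W p)))))
      where
      instance
        w>0 : Positive w
        w>0 = ℚP.nonNeg∧nonZero⇒pos w {{ℚ.nonNegative w≥0}} {{ℚ.≢-nonZero w≢0}}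

  StrictMaximiser⇒IsVertex : IsVertex L p
  StrictMaximiser⇒IsVertex = n , below-p
    where
    below-p : ∀ q → InConv L q → q ≢ p → dot n q < dot n p
    below-p q (ws , ws-ok , Σw≡1 , combo≡q) q≢p with combo-below-or-at ws ws-ok
    ... | inj₁ combo-below rewrite Σw≡1 | combo≡q =
      subst (dot n q <_) (ℚP.*-identityˡ (dot n p)) combo-below
    ... | inj₂ combo-at rewrite Σw≡1 | combo≡q =
      ⊥-elim (q≢p (trans combo-at (·ᵛ-identityˡ p)))

module _ (F : List (Vec ℕ d)) (p : Vec ℕ d) where

  PreorderMaximum : MonotonicTotalPreorder d → Set
  PreorderMaximum R = ∀ q → q ∈ F → q ≢ p → MonotonicTotalPreorder._≺_ R (toℤᵛ q) (toℤᵛ p)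

  vertex⇒preorderMaximum : IsVertex (List.map toℚᵛ F) (toℚᵛ p) → ∃ PreorderMaximum
  vertex⇒preorderMaximum vertex with IsVertex⇒StrictMaximiser vertex
  ... | n , p-max = linearPreorder n , λ q q∈ q≢p → linearPreorder-≺ n
    (subst₂ _<_ (sym (dotℤ-toℤᵛ n q)) (sym (dotℤ-toℤᵛ n p))
      (p-max (∈-map⁺ toℚᵛ q∈) (q≢p ∘ toℚᵛ-injective)))

  preorderMaximum⇒vertex : ∃ PreorderMaximum → IsVertex (List.map toℚᵛ F) (toℚᵛ p)
  preorderMaximum⇒vertex (R , p-max) = StrictMaximiser⇒IsVertex n maximiser
    where
    ≢p? : (q : Vec ℕ d) → Dec (q ≢ p)
    ≢p? q = ¬? (VecP.≡-dec ℕ._≟_ q p)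
    others : List (Vec ℤ d)
    others = List.map toℤᵛ (filter ≢p? F)
    others≺p : ∀ {x} → x ∈ others → MonotonicTotalPreorder._≺_ R x (toℤᵛ p)
    others≺p x∈ with ∈-map⁻ toℤᵛ x∈
    ... | q , q∈ , refl = let (q∈F , q≢p) = ∈-filter⁻ ≢p? q∈ in p-max q q∈F q≢p
    linearMax : ∃ λ n → ∀ {x} → x ∈ others → dotℤ n x < dotℤ n (toℤᵛ p)
    linearMax = preorderMax⇒linearMax R (toℤᵛ p) others others≺p
    n : Vec ℚ d
    n = proj₁ linearMax
    maximiser : StrictMaximiser n (List.map toℚᵛ F) (toℚᵛ p)
    maximiser x∈ x≢p with ∈-map⁻ toℚᵛ x∈
    ... | q , q∈ , refl = subst₂ _<_ (dotℤ-toℤᵛ n q) (dotℤ-toℤᵛ n p)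
      (proj₂ linearMax (∈-map⁺ toℤᵛ (∈-filter⁺ ≢p? q∈ (x≢p ∘ cong toℚᵛ))))

-- Neither direction uses the hypothesis p ∈ frame f.
theorem1 : ∀ {d : ℕ} (f : Poly d) (p : Vec ℕ d) → p ∈ frame f →
    IsVertex (newton f) (toℚᵛ p)
      ⇔ ∃ λ (R : MonotonicTotalPreorder d) →
          ∀ q → q ∈ frame f → q ≢ p →
            MonotonicTotalPreorder._≺_ R (toℤᵛ q) (toℤᵛ p)
theorem1 f p _ = mk⇔ (vertex⇒preorderMaximum (frame f) p) (preorderMaximum⇒vertex (frame f) p)
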